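{- Let $G$ be a connected graph such that $\mathcal{M}(G)\neq\emptyset$. Then $\mathcal{P}(G)\neq\emptyset$ and $\mu(G)\le\varsigma(G)$.
   Context: Graphs are simple and connected; $d$ is the shortest-path distance. A major vertex is a vertex of degree at least $3$. An end-vertex $u$ (degree $1$) is a terminal vertex of a major vertex $v$ if $d(u,v)<d(u,w)$ for every other major vertex $w$; $ter(v)$ is the number of terminal vertices of $v$. An exterior major vertex is a major vertex with $ter(v)\ge1$; $\mathcal{M}(G)$ is the set of exterior major vertices with $ter(v)>1$. For $w\in\mathcal{M}(G)$ and distinct terminal vertices $u_j,u_r$ of $w$, $\varsigma(u_j,u_r)$ is the length of the shortest path from $u_j$ to $u_r$ containing $w$; $\varsigma(w)$ is the minimum of $\varsigma(u_j,u_r)$ over pairs of distinct terminal vertices of $w$, and $\varsigma(G)=\min_{w\in\mathcal{M}(G)}\varsigma(w)$. For a vertex $v$ and positive integer $m$, $S(v,m)=\{x: d(v,x)=m\}$. A vertex separator is a set of vertices whose removal disconnects $G$. For distinct $v,v'$, a common separating subset of their $m$-spheres is a set $S\subseteq S(v,m)\cap S(v',m)$ which is a vertex separator such that some component of $G\setminus S$ contains neither $v$ nor $v'$. $\mathcal{P}_m(G)$ is the set of ordered pairs of distinct vertices whose $m$-spheres have a common separating subset, $\mathcal{P}(G)=\bigcup_m\mathcal{P}_m(G)$. For $(v,v')\in\mathcal{P}_m(G)$, $S_m(v,v')$ is the union of all such subsets, $C_m^j$ ($j\in J$) the components of $G\setminus S_m(v,v')$ containing neither $v$ nor $v'$, $\mu_m(v,v')=|\{x\in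 V(G)\setminus\bigcup_jC_m^j: d(v,x)\neq d(v',x)\}|$; $\mu_m(G)=\min_{\mathcal{P}_m(G)}\mu_m(v,v')$, $\mu(G)=\min_m\mu_m(G)$ (minimum over empty set $=+\infty$). -}

module Defs where

open import Data.Nat using (ℕ; zero; suc; _≤_; _<_)
open import Data.Bool using (Bool; true; false)
open import Data.Fin using (Fin)
open import Data.Fin.Subset using (Subset; _∈_; _∉_; ∣_∣)
open import Data.Vec using (tabulate)
open import Data.List using (List; []; _∷_)
open import Data.List.Relation.Unary.Unique.Propositional using (Unique)
import Data.List.Membership.Propositional as LM
open import Data.Product using (Σ; ∃; ∃-syntax; _×_)
open import Relation.Nullary using (¬_)
open import Relation.Binary.PropositionalEquality using (_≡_; _≢_)

record Graph (n : ℕ) : Set where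
  field
    adj    : Fin n → Fin n → Bool
    sym    : ∀ i j → adj i j ≡ adj j i
    irrefl : ∀ i → adj i i ≡ false

module _ {n : ℕ} (G : Graph n) where
  open Graph G

  data Walk : Fin n → Fin n → ℕ → Set where
    nil  : ∀ {u} → Walk u u 0
    cons : ∀ {u w v k} → adj u w ≡ true → Walk w v k → Walk u v (suc k)

  verts : ∀ {u v k} → Walk u v k → List (Fin n)
  verts {u} nil        = u ∷ []
  verts {u} (cons _ p) = u ∷ verts p

  IsPath : ∀ {u v k} → Walk u v k → Set
  IsPath p = Unique (verts p)

  Connected : Set
  Connected = ∀ u v → ∃[ k ] Walk u v k

  Dist : Fin n → Fin n → ℕ → Set
  Dist u v k = Walk u v k × (∀ l → Walk u v l → k ≤ l)

  neighbourhood : Fin n → Subset n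
  neighbourhood v = tabulate (adj v)

  deg : Fin n → ℕ
  deg v = ∣ neighbourhood v ∣

  Major : Fin n → Set
  Major v = 3 ≤ deg v

  EndVertex : Fin n → Set
  EndVertex u = deg u ≡ 1

  Card : (Fin n → Set) → ℕ → Set
  Card P k = ∃[ T ] ((∀ x → x ∈ T → P x) × (∀ x → P x → x ∈ T) × ∣ T ∣ ≡ k)

  IsMin : (ℕ → Set) → ℕ → Set
  IsMin A k = A k × (∀ l → A l → k ≤ l)

  Terminal : Fin n → Fin n → Set
  Terminal v u = EndVertex u × Major v ×
    ∃[ a ] (Dist u v a × (∀ w → Major w → w ≢ v → ∀ b → Dist u w b → a < b))

  ter : Fin n → ℕ → Set
  ter v k = Card (Terminal v) k

  ExteriorMajor : Fin n → Set
  ExteriorMajor v = Major v × ∃[ k ] (ter v k × 1 ≤ k)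

  InM : Fin n → Set
  InM v = ExteriorMajor v × ∃[ k ] (ter v k × 1 < k)

  ςpair : Fin n → Fin n → Fin n → ℕ → Set
  ςpair w uj ur = IsMin (λ l → Σ (Walk uj ur l) λ p → IsPath p × LM._∈_ w (verts p))

  ςvertex : Fin n → ℕ → Set
  ςvertex w = IsMin (λ l → ∃[ uj ] ∃[ ur ]
    (uj ≢ ur × Terminal w uj × Terminal w ur × ςpair w uj ur l))

  ςG : ℕ → Set
  ςG = IsMin (λ l → ∃[ w ] (InM w × ςvertex w l))

  -- Walks in G ∖ S (all vertices outside S); x, y in the same component of G ∖ S.
  data WalkAvoid (S : Fin n → Set) : Fin n → Fin n → Set where
    nil  : ∀ {x} → ¬ S x → WalkAvoid S x x
    cons : ∀ {x y z} → ¬ S x → adj x y ≡ true → WalkAvoid S y z → WalkAvoid S x z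

  Sphere : Fin n → ℕ → Fin n → Set
  Sphere v m x = Dist v x m

  VertexSeparator : Subset n → Set
  VertexSeparator S = ∃[ x ] ∃[ y ] (x ∉ S × y ∉ S × ¬ WalkAvoid (_∈ S) x y)

  CommonSep : ℕ → Fin n → Fin n → Subset n → Set
  CommonSep m v v' S =
    (∀ x → x ∈ S → Sphere v m x × Sphere v' m x) × VertexSeparator S ×
    ∃[ x ] (x ∉ S × ¬ WalkAvoid (_∈ S) x v × ¬ WalkAvoid (_∈ S) x v')

  Pm : ℕ → Fin n → Fin n → Set
  Pm m v v' = v ≢ v' × ∃[ S ] CommonSep m v v' S

  InSm : ℕ → Fin n → Fin n → Fin n → Set
  InSm m v v' x = ∃[ S ] (CommonSep m v v' S × x ∈ S)

  InC : ℕ → Fin n → Fin n → Fin n → Set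
  InC m v v' x = ¬ InSm m v v' x ×
    ¬ WalkAvoid (InSm m v v') x v × ¬ WalkAvoid (InSm m v v') x v'

  μpair : ℕ → Fin n → Fin n → ℕ → Set
  μpair m v v' k = Pm m v v' × Card (λ x → ¬ InC m v v' x ×
    ∃[ a ] ∃[ b ] (Dist v x a × Dist v' x b × a ≢ b)) k

  μm : ℕ → ℕ → Set
  μm m = IsMin (λ l → ∃[ v ] ∃[ v' ] (Pm m v v' × μpair m v v' l))

  μG : ℕ → Set
  μG = IsMin (λ l → ∃[ m ] (1 ≤ m × μm m l))

  PNonempty : Set
  PNonempty = ∃[ m ] ∃[ v ] ∃[ v' ] (1 ≤ m × Pm m v v')

-- A terminal vertex u of w hangs from w on a leg: the vertices other than w on shortest
-- u–w paths are not major (w is the major vertex nearest to u), so they form a path from u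
-- to a neighbour of w, its top, and the legs of distinct terminal vertices are disjoint.
-- Take w ∈ 𝓜(G) and terminal vertices uⱼ ≠ uᵣ of w realising ς(G), with tops v and v'.
-- A third neighbour of w lies on neither leg, so {w} is a common separating subset of the
-- 1-spheres of v and v', and w is the only vertex of both spheres; hence (v,v') ∈ 𝓟₁(G).
-- The vertices counted by μ₁(v,v') are then exactly those of the two legs, and a path
-- from uⱼ to uᵣ through w contains both legs and w, so μ(G) ≤ μ₁(v,v') ≤ ς(G). All the
-- minima involved exist because their defining predicates are decidable.

module Submission where

open import Defs
open import Data.Bool using (Bool; true)
import Data.Bool as Bool
open import Data.Unit using (tt) renaming (⊤ to Unit)
open import Data.Fin using (Fin; zero; suc)
open import Data.Fin.Properties using (any?; all?) renaming (_≟_ to _≟ᶠ_)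
open import Data.Fin.Subset using (Subset; _∈_; _∉_; _⊆_; ∣_∣; _-_; _∪_; ⊤; ⁅_⁆; inside; outside)
open import Data.Fin.Subset.Properties
  using (⊆-antisym; p─⊥≡p; p─q⊆p; x∈p∧x≢y⇒x∈p-y; x∈p⇒∣p-x∣<∣p∣; ∣⊤∣≡n; ∈⊤; Empty-unique; ∣⊥∣≡0;
         x∈⁅x⁆; x∈⁅y⁆⇒x≡y; x≢y⇒x∉⁅y⁆; p⊆q⇒∣p∣≤∣q∣; p⊆p∪q; q⊆p∪q; x∈p∪q⁻; anySubset?)
  renaming (_∈?_ to _∈ˢ?_)
open import Data.List using (List; []; _∷_; length)
open import Data.List.Membership.Propositional using () renaming (_∈_ to _∈ˡ_)
open import Data.List.Relation.Unary.Any using (here; there)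
open import Data.List.Relation.Unary.All using (All; []; _∷_; zipWith)
import Data.List.Relation.Unary.All as All
open import Data.List.Relation.Unary.All.Properties using (¬Any⇒All¬)
import Data.List.Membership.DecPropositional as DecMembership
import Data.List.Relation.Unary.Unique.DecPropositional as DecUnique
open import Data.List.Relation.Unary.AllPairs using ([]; _∷_)
open import Data.List.Relation.Unary.Unique.Propositional using (Unique)
open import Data.Nat using (ℕ; zero; suc; _+_; _≤_; _<_; z≤n; s≤s; z<s; s≤s⁻¹; _≟_; _≤?_; _<?_)
open import Data.Nat.Induction using (<-rec)
open import Data.Nat.Properties
open import Data.Product using (Σ; ∃; ∃-syntax; _×_; _,_; proj₁; proj₂; uncurry)
open import Data.Sum using (_⊎_; inj₁; inj₂)
open import Data.Vec using (_∷_; here; there; tabulate)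
open import Data.Vec.Properties using (lookup∘tabulate; []=⇒lookup; lookup⇒[]=)
open import Function using (_∘_; id)
open import Relation.Nullary using (¬_; Dec; yes; no; does; ¬?; _×-dec_; _→-dec_; contradiction)
open import Relation.Nullary.Decidable using (map′; dec-true; _⊎-dec_)
open import Relation.Unary using (Decidable)
open import Relation.Binary.PropositionalEquality
  using (_≡_; _≢_; refl; sym; trans; cong; cong₂; subst; subst₂; module ≡-Reasoning)

-- `Least A` and `Count P` are Defs' `IsMin G A` and `Card G P`, which do not depend on G.

Least : (ℕ → Set) → ℕ → Set
Least A k = A k × (∀ l → A l → k ≤ l)

Count : ∀ {n} → (Fin n → Set) → ℕ → Set
Count P k = ∃[ T ] ((∀ x → x ∈ T → P x) × (∀ x → P x → x ∈ T) × ∣ T ∣ ≡ k)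

least-unique : ∀ {A k l} → Least A k → Least A l → k ≡ l
least-unique (ak , k-min) (al , l-min) = ≤-antisym (k-min _ al) (l-min _ ak)

module _ {A : ℕ → Set} (A? : Decidable A) where

  private
    least-intro : ∀ {k} → A k → ¬ (∃ λ l → l < k × A l) → Least A k
    least-intro ak none-below = ak , λ l al → ≮⇒≥ (λ l<k → none-below (l , l<k , al))

  least? : ∀ k → Dec (Least A k)
  least? k = map′ (uncurry least-intro) least-elim (A? k ×-dec ¬? (anyUpTo? A? k))
    where
    least-elim : Least A k → A k × ¬ (∃ λ l → l < k × A l)
    least-elim (ak , k-min) = ak , λ (l , l<k , al) → <⇒≱ l<k (k-min l al)

  least-exists : ∀ {k} → A k → ∃ (Least A)
  least-exists {k} = <-rec (λ k → A k → ∃ (Least A)) descend k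
    where
    descend : ∀ k → (∀ {l} → l < k → A l → ∃ (Least A)) → A k → ∃ (Least A)
    descend k below ak with anyUpTo? A? k
    ... | yes (l , l<k , al) = below l<k al
    ... | no none-below      = k , least-intro ak none-below

∣p∣≤1+∣p-x∣ : ∀ {n} (p : Subset n) x → ∣ p ∣ ≤ suc ∣ p - x ∣
∣p∣≤1+∣p-x∣ (inside  ∷ p) zero    = s≤s (≤-reflexive (cong ∣_∣ (sym (p─⊥≡p p))))
∣p∣≤1+∣p-x∣ (outside ∷ p) zero    = m≤n⇒m≤1+n (≤-reflexive (cong ∣_∣ (sym (p─⊥≡p p))))
∣p∣≤1+∣p-x∣ (inside  ∷ p) (suc x) = s≤s (∣p∣≤1+∣p-x∣ p x)
∣p∣≤1+∣p-x∣ (outside ∷ p) (suc x) = ∣p∣≤1+∣p-x∣ p x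

x∉p-x : ∀ {n} (p : Subset n) x → x ∉ p - x
x∉p-x (inside  ∷ p) zero    ()
x∉p-x (outside ∷ p) zero    ()
x∉p-x (_       ∷ p) (suc x) (there x∈p-x) = x∉p-x p x x∈p-x

∈-tabulate⁺ : ∀ {n} (f : Fin n → Bool) {x} → f x ≡ true → x ∈ tabulate f
∈-tabulate⁺ f {x} fx≡true = lookup⇒[]= x (tabulate f) (trans (lookup∘tabulate f x) fx≡true)

∈-tabulate⁻ : ∀ {n} (f : Fin n → Bool) {x} → x ∈ tabulate f → f x ≡ true
∈-tabulate⁻ f {x} x∈ = trans (sym (lookup∘tabulate f x)) ([]=⇒lookup x∈)

_∈ˡ?_ : ∀ {n} (x : Fin n) (xs : List (Fin n)) → Dec (x ∈ˡ xs)
_∈ˡ?_ {n} = DecMembership._∈?_ (_≟ᶠ_ {n})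

module _ {n : ℕ} where

  ∣p∣≤length : (p : Subset n) (xs : List (Fin n)) → (∀ {x} → x ∈ p → x ∈ˡ xs) → ∣ p ∣ ≤ length xs
  ∣p∣≤length p [] p⊆[] =
    ≤-reflexive (trans (cong ∣_∣ (Empty-unique λ (_ , x∈p) → contradiction (p⊆[] x∈p) λ ())) (∣⊥∣≡0 n))
  ∣p∣≤length p (y ∷ ys) p⊆y∷ys = ≤-trans (∣p∣≤1+∣p-x∣ p y) (s≤s (∣p∣≤length (p - y) ys p-y⊆ys))
    where
    p-y⊆ys : ∀ {x} → x ∈ p - y → x ∈ˡ ys
    p-y⊆ys {x} x∈p-y with p⊆y∷ys (p─q⊆p p ⁅ y ⁆ x∈p-y)
    ... | here refl  = contradiction x∈p-y (x∉p-x p x)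
    ... | there x∈ys = x∈ys

  ∣p∣<length : (p : Subset n) (xs : List (Fin n)) → (∀ {y} → y ∈ p → y ∈ˡ xs) →
               ∀ {x} → x ∈ˡ xs → x ∉ p → ∣ p ∣ < length xs
  ∣p∣<length p xs p⊆xs {x} x∈xs x∉p = begin-strict
    ∣ p ∣          ≤⟨ p⊆q⇒∣p∣≤∣q∣ p⊆q-x ⟩
    ∣ q - x ∣      <⟨ x∈p⇒∣p-x∣<∣p∣ (q⊆p∪q p ⁅ x ⁆ (x∈⁅x⁆ x)) ⟩
    ∣ q ∣          ≤⟨ ∣p∣≤length q xs q⊆xs ⟩
    length xs      ∎
    where
    open ≤-Reasoning
    q = p ∪ ⁅ x ⁆
    p⊆q-x : p ⊆ q - x
    p⊆q-x y∈p = x∈p∧x≢y⇒x∈p-y (p⊆p∪q ⁅ x ⁆ y∈p) λ { refl → x∉p y∈p }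
    q⊆xs : ∀ {y} → y ∈ q → y ∈ˡ xs
    q⊆xs y∈q with x∈p∪q⁻ p ⁅ x ⁆ y∈q
    ... | inj₁ y∈p  = p⊆xs y∈p
    ... | inj₂ y∈⁅x⁆ = subst (_∈ˡ xs) (sym (x∈⁅y⁆⇒x≡y x y∈⁅x⁆)) x∈xs

  length≤∣p∣ : (p : Subset n) {xs : List (Fin n)} → Unique xs → All (_∈ p) xs → length xs ≤ ∣ p ∣
  length≤∣p∣ p []                       []              = z≤n
  length≤∣p∣ p {x ∷ _} (x≢xs ∷ unique-xs) (x∈p ∷ xs⊆p) =
    ≤-<-trans (length≤∣p∣ (p - x) unique-xs xs⊆p-x) (x∈p⇒∣p-x∣<∣p∣ x∈p)
    where
    xs⊆p-x = zipWith (λ (x≢y , y∈p) → x∈p∧x≢y⇒x∈p-y y∈p (x≢y ∘ sym)) (x≢xs , xs⊆p)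

  length<∣p∣⇒∃∉ : (p : Subset n) (xs : List (Fin n)) → length xs < ∣ p ∣ → ∃ λ y → y ∈ p × ¬ y ∈ˡ xs
  length<∣p∣⇒∃∉ p xs length<∣p∣ with any? (λ y → y ∈ˢ? p ×-dec ¬? (y ∈ˡ? xs))
  ... | yes found = found
  ... | no none   = contradiction (∣p∣≤length p xs p⊆xs) (<⇒≱ length<∣p∣)
    where
    p⊆xs : ∀ {x} → x ∈ p → x ∈ˡ xs
    p⊆xs {x} x∈p with x ∈ˡ? xs
    ... | yes x∈xs = x∈xs
    ... | no  x∉xs = contradiction (x , x∈p , x∉xs) none

  two-distinct : (p : Subset n) → 1 < ∣ p ∣ → ∃ λ x → ∃ λ y → x ∈ p × y ∈ p × x ≢ y
  two-distinct p 1<∣p∣ with length<∣p∣⇒∃∉ p [] (<-trans z<s 1<∣p∣)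
  ... | x , x∈p , _ with length<∣p∣⇒∃∉ p (x ∷ []) 1<∣p∣
  ...   | y , y∈p , y≠x = x , y , x∈p , y∈p , λ x≡y → y≠x (here (sym x≡y))

module _ {n : ℕ} {P : Fin n → Set} where

  count-unique : ∀ {k l} → Count P k → Count P l → k ≡ l
  count-unique (T , T⊆P , P⊆T , ∣T∣≡k) (U , U⊆P , P⊆U , ∣U∣≡l) =
    trans (sym ∣T∣≡k) (trans (cong ∣_∣ (⊆-antisym (P⊆U _ ∘ T⊆P _) (P⊆T _ ∘ U⊆P _))) ∣U∣≡l)

  count-resp : ∀ {Q : Fin n → Set} → (∀ x → P x → Q x) → (∀ x → Q x → P x) → ∀ {k} → Count P k → Count Q k
  count-resp P⇒Q Q⇒P (T , T⊆P , P⊆T , ∣T∣≡k) = T , (λ x → P⇒Q x ∘ T⊆P x) , (λ x → P⊆T x ∘ Q⇒P x) , ∣T∣≡k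

  count-exists : Decidable P → ∃ (Count P)
  count-exists P? = _ , tabulate (does ∘ P?) , (λ x → witness (P? x) ∘ ∈-tabulate⁻ _)
                                              , (λ x → ∈-tabulate⁺ _ ∘ dec-true (P? x)) , refl
    where
    witness : ∀ {A : Set} (a? : Dec A) → does a? ≡ true → A
    witness (yes a) _ = a

  count? : Decidable P → ∀ k → Dec (Count P k)
  count? P? k with count-exists P?
  ... | c , count-c = map′ (λ { refl → count-c }) (λ count-k → count-unique count-k count-c) (k ≟ c)

module Walks {n : ℕ} (G : Graph n) where
  open Graph G renaming (sym to adj-sym)

  private variable
    x y z : Fin n
    k l : ℕ
    S : Fin n → Set

  adj⇒≢ : adj x y ≡ true → x ≢ y
  adj⇒≢ {x} x~y refl = contradiction (trans (sym x~y) (irrefl x)) λ ()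

  _++ʷ_ : Walk G x y k → Walk G y z l → Walk G x z (k + l)
  nil        ++ʷ q = q
  cons x~ p  ++ʷ q = cons x~ (p ++ʷ q)

  snocʷ : Walk G x y k → adj y z ≡ true → Walk G x z (suc k)
  snocʷ nil         y~z = cons y~z nil
  snocʷ (cons x~ p) y~z = cons x~ (snocʷ p y~z)

  reverseʷ : Walk G x y k → Walk G y x k
  reverseʷ nil                   = nil
  reverseʷ (cons {u} {w} u~w p) = snocʷ (reverseʷ p) (trans (adj-sym w u) u~w)

  verts-length : (p : Walk G x y k) → length (verts G p) ≡ suc k
  verts-length nil        = refl
  verts-length (cons _ p) = cong suc (verts-length p)

  ∈-verts-snoc : (p : Walk G x y k) (y~z : adj y z ≡ true) →
                 ∀ {t} → t ∈ˡ verts G (snocʷ p y~z) → t ∈ˡ verts G p ⊎ t ≡ z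
  ∈-verts-snoc nil        y~z (here t≡x)         = inj₁ (here t≡x)
  ∈-verts-snoc nil        y~z (there (here t≡z)) = inj₂ t≡z
  ∈-verts-snoc (cons _ p) y~z (here t≡x)         = inj₁ (here t≡x)
  ∈-verts-snoc (cons _ p) y~z (there t∈)         with ∈-verts-snoc p y~z t∈
  ... | inj₁ t∈p = inj₁ (there t∈p)
  ... | inj₂ t≡z = inj₂ t≡z

  ∈-verts-reverse : (p : Walk G x y k) → ∀ {t} → t ∈ˡ verts G (reverseʷ p) → t ∈ˡ verts G p
  ∈-verts-reverse nil t∈ = t∈
  ∈-verts-reverse (cons u~w p) t∈ with ∈-verts-snoc (reverseʷ p) _ t∈
  ... | inj₁ t∈rev  = there (∈-verts-reverse p t∈rev)
  ... | inj₂ refl   = here refl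

  avoiding⇒walk : WalkAvoid G S x y → ∃ λ k → Σ (Walk G x y k) λ p → All (¬_ ∘ S) (verts G p)
  avoiding⇒walk (nil ¬Sx) = 0 , nil , ¬Sx ∷ []
  avoiding⇒walk (cons ¬Sx x~ q) with avoiding⇒walk q
  ... | k , p , p-avoids = suc k , cons x~ p , ¬Sx ∷ p-avoids

  walk⇒avoiding : (p : Walk G x y k) → All (¬_ ∘ S) (verts G p) → WalkAvoid G S x y
  walk⇒avoiding nil         (¬Sx ∷ []) = nil ¬Sx
  walk⇒avoiding (cons x~ p) (¬Sx ∷ p-avoids) = cons ¬Sx x~ (walk⇒avoiding p p-avoids)

  avoiding-start : WalkAvoid G S x y → ¬ S x
  avoiding-start (nil ¬Sx)      = ¬Sx
  avoiding-start (cons ¬Sx _ _) = ¬Sx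

  _++ᵃ_ : WalkAvoid G S x y → WalkAvoid G S y z → WalkAvoid G S x z
  nil _          ++ᵃ q = q
  cons ¬Sx x~ p ++ᵃ q = cons ¬Sx x~ (p ++ᵃ q)

  reverseᵃ : WalkAvoid G S x y → WalkAvoid G S y x
  reverseᵃ q with avoiding⇒walk q
  ... | _ , p , p-avoids =
    walk⇒avoiding (reverseʷ p) (All.tabulate (All.lookup p-avoids ∘ ∈-verts-reverse p))

  private
    suffix : (p : Walk G y z k) → x ∈ˡ verts G p → ∃ λ l → Σ (Walk G x z l) λ q →
             (IsPath G p → IsPath G q) × (∀ {t} → t ∈ˡ verts G q → t ∈ˡ verts G p)
    suffix nil          (here refl) = _ , nil , id , id
    suffix p@(cons _ _) (here refl) = _ , p , id , id
    suffix (cons _ p)   (there x∈p) with suffix p x∈p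
    ... | l , q , keeps-path , q⊆p = l , q , (λ { (_ ∷ path) → keeps-path path }) , there ∘ q⊆p

  walk⇒path : (p : Walk G x y k) → ∃ λ l → Σ (Walk G x y l) λ q →
              IsPath G q × (∀ {t} → t ∈ˡ verts G q → t ∈ˡ verts G p)
  walk⇒path nil = _ , nil , [] ∷ [] , id
  walk⇒path {x} (cons x~ p) with walk⇒path p
  ... | l , q , path-q , q⊆p with x ∈ˡ? verts G q
  ...   | yes x∈q = let l' , r , keeps-path , r⊆q = suffix q x∈q
                    in l' , r , keeps-path path-q , there ∘ q⊆p ∘ r⊆q
  ...   | no  x∉q = suc l , cons x~ q , ¬Any⇒All¬ _ x∉q ∷ path-q ,
                    λ { (here t≡x) → here t≡x ; (there t∈q) → there (q⊆p t∈q) }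

  path-length<n : (p : Walk G x y k) → IsPath G p → k < n
  path-length<n p path =
    subst₂ _≤_ (verts-length p) (∣⊤∣≡n n) (length≤∣p∣ ⊤ path (All.tabulate λ _ → ∈⊤))

  walkWith? : {R : List (Fin n) → Set} → Decidable R → ∀ x y k → Dec (Σ (Walk G x y k) (R ∘ verts G))
  walkWith? R? x y zero with x ≟ᶠ y
  ... | no x≢y   = no λ { (nil , _) → x≢y refl }
  ... | yes refl = map′ (nil ,_) (λ { (nil , r) → r }) (R? (x ∷ []))
  walkWith? {R} R? x y (suc k) =
    map′ (λ (z , x~z , p , r) → cons x~z p , r) (λ { (cons x~z p , r) → _ , x~z , p , r })
         (any? λ z → (adj x z Bool.≟ true) ×-dec walkWith? {R ∘ (x ∷_)} (R? ∘ (x ∷_)) z y k)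

  walk? : ∀ x y k → Dec (Walk G x y k)
  walk? x y k = map′ proj₁ (_, tt) (walkWith? {λ _ → Unit} (λ _ → yes tt) x y k)

  -- Loop removal shortens an avoiding walk to a path, so walks of length < n suffice.
  avoiding? : Decidable S → ∀ x y → Dec (WalkAvoid G S x y)
  avoiding? {S} S? x y =
    map′ (λ (_ , _ , p , p-avoids) → walk⇒avoiding p p-avoids) short-avoiding
         (anyUpTo? (walkWith? (All.all? (¬? ∘ S?)) x y) n)
    where
    short-avoiding : WalkAvoid G S x y → ∃ λ k → k < n × Σ (Walk G x y k) λ p → All (¬_ ∘ S) (verts G p)
    short-avoiding q with avoiding⇒walk q
    ... | _ , p , p-avoids with walk⇒path p
    ...   | k , r , path-r , r⊆p = k , path-length<n r path-r , r , All.tabulate (All.lookup p-avoids ∘ r⊆p)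

  -- Degrees

  ∈-neighbourhood⁺ : adj x y ≡ true → y ∈ neighbourhood G x
  ∈-neighbourhood⁺ {x} = ∈-tabulate⁺ (adj x)

  ∈-neighbourhood⁻ : y ∈ neighbourhood G x → adj x y ≡ true
  ∈-neighbourhood⁻ {x = x} = ∈-tabulate⁻ (adj x)

  distinct-neighbours≤deg : {ys : List (Fin n)} → Unique ys → All (λ y → adj x y ≡ true) ys → length ys ≤ deg G x
  distinct-neighbours≤deg unique x~ys = length≤∣p∣ (neighbourhood G _) unique (All.map ∈-neighbourhood⁺ x~ys)

  end-vertex-neighbour-unique : EndVertex G x → adj x y ≡ true → adj x z ≡ true → y ≡ z
  end-vertex-neighbour-unique {y = y} {z} deg≡1 x~y x~z with y ≟ᶠ z
  ... | yes y≡z = y≡z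
  ... | no  y≢z = contradiction (≤-trans (distinct-neighbours≤deg ((y≢z ∷ []) ∷ [] ∷ []) (x~y ∷ x~z ∷ []))
                                         (≤-reflexive deg≡1))
                                λ { (s≤s ()) }

  non-major-neighbours : ¬ Major G x → adj x y ≡ true → adj x z ≡ true → y ≢ z →
                         ∀ {t} → adj x t ≡ true → t ≡ y ⊎ t ≡ z
  non-major-neighbours {y = y} {z} ¬major x~y x~z y≢z {t} x~t with t ≟ᶠ y | t ≟ᶠ z
  ... | yes t≡y | _       = inj₁ t≡y
  ... | no  _   | yes t≡z = inj₂ t≡z
  ... | no  t≢y | no  t≢z =
    contradiction (distinct-neighbours≤deg ((y≢z ∷ (t≢y ∘ sym) ∷ []) ∷ ((t≢z ∘ sym) ∷ []) ∷ [] ∷ [])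
                                           (x~y ∷ x~z ∷ x~t ∷ []))
                  ¬major

  major⇒other-neighbour : Major G x → ∀ y z → ∃ λ t → adj x t ≡ true × t ≢ y × t ≢ z
  major⇒other-neighbour {x} major y z with length<∣p∣⇒∃∉ (neighbourhood G x) (y ∷ z ∷ []) major
  ... | t , t∈N , t∉ = t , ∈-neighbourhood⁻ t∈N , (λ t≡y → t∉ (here t≡y)) , (λ t≡z → t∉ (there (here t≡z)))

module Distances {n : ℕ} (G : Graph n) (connected : Connected G) where
  open Graph G renaming (sym to adj-sym)
  open Walks G

  private variable
    u w x y z : Fin n
    k : ℕ
    S : Fin n → Set

  abstract
    dist : Fin n → Fin n → ℕ
    dist x y = proj₁ (least-exists (walk? x y) (proj₂ (connected x y)))

    dist-is-Dist : ∀ x y → Dist G x y (dist x y)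
    dist-is-Dist x y = proj₂ (least-exists (walk? x y) (proj₂ (connected x y)))

  geodesic : ∀ x y → Walk G x y (dist x y)
  geodesic x y = proj₁ (dist-is-Dist x y)

  Dist⇒≡dist : Dist G x y k → k ≡ dist x y
  Dist⇒≡dist {x} {y} d = least-unique d (dist-is-Dist x y)

  dist-minimal : Walk G x y k → dist x y ≤ k
  dist-minimal {x} {y} p = proj₂ (dist-is-Dist x y) _ p

  dist-triangle : ∀ x y z → dist x z ≤ dist x y + dist y z
  dist-triangle x y z = dist-minimal (geodesic x y ++ʷ geodesic y z)

  dist-sym : ∀ x y → dist x y ≡ dist y x
  dist-sym x y = ≤-antisym (dist-minimal (reverseʷ (geodesic y x))) (dist-minimal (reverseʷ (geodesic x y)))

  dist-refl : ∀ x → dist x x ≡ 0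
  dist-refl x = n≤0⇒n≡0 (dist-minimal (nil {u = x}))

  dist≡0⇒≡ : dist x y ≡ 0 → x ≡ y
  dist≡0⇒≡ {x} {y} d≡0 with subst (Walk G x y) d≡0 (geodesic x y)
  ... | nil = refl

  adj⇒dist≡1 : adj x y ≡ true → dist x y ≡ 1
  adj⇒dist≡1 {x} {y} x~y = ≤-antisym (dist-minimal (cons x~y nil)) (n≢0⇒n>0 (adj⇒≢ x~y ∘ dist≡0⇒≡))

  adj⇒Dist1 : adj x y ≡ true → Dist G x y 1
  adj⇒Dist1 {x} {y} x~y = subst (Dist G x y) (adj⇒dist≡1 x~y) (dist-is-Dist x y)

  Dist1⇒adj : Dist G x y 1 → adj x y ≡ true
  Dist1⇒adj (cons x~y nil , _) = x~y

  terminal⇒nearest : Terminal G w u → Major G x → x ≢ w → dist u w < dist u x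
  terminal⇒nearest {u = u} {x} (_ , _ , _ , d , nearest) x-major x≢w =
    subst (_< dist u x) (Dist⇒≡dist d) (nearest x x-major x≢w _ (dist-is-Dist u x))

  closer-neighbour : x ≢ z → ∃ λ y → adj x y ≡ true × suc (dist y z) ≡ dist x z
  closer-neighbour {x} {z} x≢z = first-step (geodesic x z) x≢z refl
    where
    first-step : ∀ {x k} → Walk G x z k → x ≢ z → k ≡ dist x z → ∃ λ y → adj x y ≡ true × suc (dist y z) ≡ dist x z
    first-step nil                  z≢z _     = contradiction refl z≢z
    first-step {x} (cons {w = y} x~y p) _ 1+k≡d = y , x~y , ≤-antisym
      (subst (suc (dist y z) ≤_) 1+k≡d (s≤s (dist-minimal p)))
      (begin
        dist x z             ≤⟨ dist-triangle x y z ⟩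
        dist x y + dist y z  ≡⟨ cong (_+ dist y z) (adj⇒dist≡1 x~y) ⟩
        suc (dist y z)       ∎)
      where open ≤-Reasoning

  module Leg {w u : Fin n} (u-terminal : Terminal G w u) where

    leg-length : ℕ
    leg-length = dist u w

    OnLeg : Fin n → Set
    OnLeg x = x ≢ w × dist u x + dist x w ≡ leg-length

    on-leg? : Decidable OnLeg
    on-leg? x = ¬? (x ≟ᶠ w) ×-dec (dist u x + dist x w ≟ leg-length)

    u-end : EndVertex G u
    u-end = proj₁ u-terminal

    w-major : Major G w
    w-major = proj₁ (proj₂ u-terminal)

    u≢w : u ≢ w
    u≢w refl = contradiction (≤-trans w-major (≤-reflexive u-end)) λ { (s≤s ()) }

    u-on-leg : OnLeg u
    u-on-leg = u≢w , cong (_+ leg-length) (dist-refl u)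

    dist<leg-length : OnLeg x → dist u x < leg-length
    dist<leg-length {x} (x≢w , on-geodesic) =
      subst (dist u x <_) on-geodesic (m<m+n (dist u x) (n≢0⇒n>0 (x≢w ∘ dist≡0⇒≡)))

    on-leg⇒¬major : OnLeg x → ¬ Major G x
    on-leg⇒¬major x∈L@(x≢w , _) x-major = <-asym (dist<leg-length x∈L) (terminal⇒nearest u-terminal x-major x≢w)

    adj-w⇒1+dist≡leg-length : OnLeg x → adj x w ≡ true → suc (dist u x) ≡ leg-length
    adj-w⇒1+dist≡leg-length {x} (_ , on-geodesic) x~w = begin
      suc (dist u x)          ≡⟨ +-comm 1 (dist u x) ⟩
      dist u x + 1            ≡⟨ cong (dist u x +_) (adj⇒dist≡1 x~w) ⟨
      dist u x + dist x w     ≡⟨ on-geodesic ⟩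
      leg-length              ∎
      where open ≡-Reasoning

    predecessor : x ≢ u → ∃ λ z → adj x z ≡ true × suc (dist u z) ≡ dist u x
    predecessor {x} x≢u with closer-neighbour x≢u
    ... | z , x~z , closer = z , x~z , subst₂ (λ d d' → suc d ≡ d') (dist-sym z u) (dist-sym x u) closer

    record Successor (x : Fin n) : Set where
      field
        next         : Fin n
        adj-next     : adj x next ≡ true
        next-closer  : suc (dist next w) ≡ dist x w
        next-farther : dist u next ≡ suc (dist u x)

    open Successor

    successor : OnLeg x → Successor x
    successor {x} (x≢w , on-geodesic) with closer-neighbour x≢w
    ... | z , x~z , closer = record
      { next = z ; adj-next = x~z ; next-closer = closer ; next-farther = ≤-antisym farther⁻ farther⁺ }
      where
      open ≤-Reasoning
      farther⁻ : dist u z ≤ suc (dist u x)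
      farther⁻ = begin
        dist u z             ≤⟨ dist-triangle u x z ⟩
        dist u x + dist x z  ≡⟨ cong (dist u x +_) (adj⇒dist≡1 x~z) ⟩
        dist u x + 1         ≡⟨ +-comm (dist u x) 1 ⟩
        suc (dist u x)       ∎
      farther⁺ : suc (dist u x) ≤ dist u z
      farther⁺ = +-cancelʳ-≤ (dist z w) _ _ (begin
        suc (dist u x) + dist z w   ≡⟨ +-suc (dist u x) (dist z w) ⟨
        dist u x + suc (dist z w)   ≡⟨ cong (dist u x +_) closer ⟩
        dist u x + dist x w         ≡⟨ on-geodesic ⟩
        leg-length                  ≤⟨ dist-triangle u z w ⟩
        dist u z + dist z w         ∎)

    predecessor≢successor : (x∈L : OnLeg x) → suc (dist u z) ≡ dist u x → z ≢ next (successor x∈L)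
    predecessor≢successor {x} x∈L z-closer refl =
      m≢1+n+m (dist u x) {1} (trans (sym z-closer) (cong suc (next-farther (successor x∈L))))

    other-neighbour : (x∈L : OnLeg x) → adj x y ≡ true → y ≢ next (successor x∈L) → suc (dist u y) ≡ dist u x
    other-neighbour {x} {y} x∈L x~y y≢next with x ≟ᶠ u
    ... | yes refl = contradiction (end-vertex-neighbour-unique u-end x~y (adj-next (successor x∈L))) y≢next
    ... | no  x≢u with predecessor x≢u
    ...   | z , x~z , z-closer with non-major-neighbours (on-leg⇒¬major x∈L) x~z (adj-next (successor x∈L))
                                                         (predecessor≢successor x∈L z-closer) x~y
    ...     | inj₁ refl   = z-closer
    ...     | inj₂ y≡next = contradiction y≡next y≢next

    successor-unique : (x∈L : OnLeg x) → adj x y ≡ true → dist u y ≡ suc (dist u x) → y ≡ next (successor x∈L)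
    successor-unique {x} {y} x∈L x~y y-farther with y ≟ᶠ next (successor x∈L)
    ... | yes y≡next = y≡next
    ... | no  y≢next = contradiction (trans (cong suc (sym y-farther)) (other-neighbour x∈L x~y y≢next))
                                     (m≢1+n+m (dist u x) {1} ∘ sym)

    step-on-leg : OnLeg x → adj x y ≡ true → y ≢ w → OnLeg y
    step-on-leg {x} {y} x∈L@(_ , on-geodesic) x~y y≢w with y ≟ᶠ next (successor x∈L)
    ... | yes refl = y≢w , (begin
      dist u y + dist y w          ≡⟨ cong (_+ dist y w) (next-farther (successor x∈L)) ⟩
      suc (dist u x) + dist y w    ≡⟨ +-suc (dist u x) (dist y w) ⟨
      dist u x + suc (dist y w)    ≡⟨ cong (dist u x +_) (next-closer (successor x∈L)) ⟩
      dist u x + dist x w          ≡⟨ on-geodesic ⟩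
      leg-length                   ∎)
      where open ≡-Reasoning
    ... | no y≢next = y≢w , ≤-antisym on-geodesic⁻ (dist-triangle u y w)
      where
      open ≤-Reasoning
      y~x : adj y x ≡ true
      y~x = trans (adj-sym y x) x~y
      on-geodesic⁻ : dist u y + dist y w ≤ leg-length
      on-geodesic⁻ = begin
        dist u y + dist y w               ≤⟨ +-monoʳ-≤ (dist u y) (dist-triangle y x w) ⟩
        dist u y + (dist y x + dist x w)  ≡⟨ cong (λ d → dist u y + (d + dist x w)) (adj⇒dist≡1 y~x) ⟩
        dist u y + suc (dist x w)         ≡⟨ +-suc (dist u y) (dist x w) ⟩
        suc (dist u y) + dist x w         ≡⟨ cong (_+ dist x w) (other-neighbour x∈L x~y y≢next) ⟩
        dist u x + dist x w               ≡⟨ on-geodesic ⟩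
        leg-length                        ∎

    predecessor-on-leg : OnLeg x → dist u x ≡ suc k → ∃ λ z → adj x z ≡ true × dist u z ≡ k × OnLeg z
    predecessor-on-leg {x} {k} x∈L d≡1+k with predecessor x≢u
      where
      x≢u : x ≢ u
      x≢u refl = contradiction (trans (sym (dist-refl u)) d≡1+k) λ ()
    ... | z , x~z , z-closer = z , x~z , d≡k , step-on-leg x∈L x~z z≢w
      where
      d≡k : dist u z ≡ k
      d≡k = suc-injective (trans z-closer d≡1+k)
      z≢w : z ≢ w
      z≢w refl = <-asym (dist<leg-length x∈L) (subst (dist u w <_) z-closer (n<1+n (dist u w)))

    on-leg-dist-injective : OnLeg x → OnLeg y → dist u x ≡ dist u y → x ≡ y
    on-leg-dist-injective x∈L y∈L d≡d = go _ x∈L y∈L refl (sym d≡d)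
      where
      go : ∀ k {x y} → OnLeg x → OnLeg y → dist u x ≡ k → dist u y ≡ k → x ≡ y
      go zero    _ _ dx≡0 dy≡0 = trans (sym (dist≡0⇒≡ dx≡0)) (dist≡0⇒≡ dy≡0)
      go (suc k) {x} {y} x∈L y∈L dx≡1+k dy≡1+k
        with predecessor-on-leg x∈L dx≡1+k | predecessor-on-leg y∈L dy≡1+k
      ... | z , x~z , dz≡k , z∈L | z' , y~z' , dz'≡k , z'∈L with go k z∈L z'∈L dz≡k dz'≡k
      ... | refl = trans (successor-unique z∈L (trans (adj-sym z x) x~z) (trans dx≡1+k (cong suc (sym dz≡k))))
                         (sym (successor-unique z∈L (trans (adj-sym z y) y~z') (trans dy≡1+k (cong suc (sym dz≡k)))))

    end-vertex-on-leg : OnLeg x → EndVertex G x → x ≡ u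
    end-vertex-on-leg {x} x∈L x-end with x ≟ᶠ u
    ... | yes x≡u = x≡u
    ... | no  x≢u with predecessor x≢u
    ...   | z , x~z , z-closer = contradiction (end-vertex-neighbour-unique x-end x~z (adj-next (successor x∈L)))
                                               (predecessor≢successor x∈L z-closer)

    avoiding-w-stays-on-leg : S w → WalkAvoid G S x y → OnLeg x → OnLeg y
    avoiding-w-stays-on-leg Sw (nil _)       x∈L = x∈L
    avoiding-w-stays-on-leg Sw (cons _ x~ q) x∈L =
      avoiding-w-stays-on-leg Sw q (step-on-leg x∈L x~ λ { refl → avoiding-start q Sw })

    leaving-leg-visits-w : Walk G x y k → OnLeg x → ¬ OnLeg y →
                           ∃ λ k₁ → ∃ λ k₂ → k₁ + k₂ ≡ k × Walk G x w k₁ × Walk G w y k₂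
    leaving-leg-visits-w nil x∈L y∉L = contradiction x∈L y∉L
    leaving-leg-visits-w (cons {w = x'} x~x' p) x∈L y∉L with x' ≟ᶠ w
    ... | yes refl = 1 , _ , refl , cons x~x' nil , p
    ... | no x'≢w with leaving-leg-visits-w p (step-on-leg x∈L x~x' x'≢w) y∉L
    ...   | k₁ , k₂ , k₁+k₂≡k , p₁ , p₂ = suc k₁ , k₂ , cong suc k₁+k₂≡k , cons x~x' p₁ , p₂

    dist-leaving-leg : OnLeg x → ¬ OnLeg y → dist x w + dist w y ≤ dist x y
    dist-leaving-leg {x} {y} x∈L y∉L with leaving-leg-visits-w (geodesic x y) x∈L y∉L
    ... | k₁ , k₂ , k₁+k₂≡d , p₁ , p₂ =
      subst (dist x w + dist w y ≤_) k₁+k₂≡d (+-mono-≤ (dist-minimal p₁) (dist-minimal p₂))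

    descent : (∀ {z} → S z → z ≡ w) → OnLeg x → WalkAvoid G S x u
    descent {S} S⊆w x∈L = go _ x∈L refl
      where
      go : ∀ k {x} → OnLeg x → dist u x ≡ k → WalkAvoid G S x u
      go zero    {x} (x≢w , _) dx≡0 = subst (WalkAvoid G S x) (sym (dist≡0⇒≡ dx≡0)) (nil (x≢w ∘ S⊆w))
      go (suc k) x∈L@(x≢w , _) dx≡1+k with predecessor-on-leg x∈L dx≡1+k
      ... | z , x~z , dz≡k , z∈L = cons (x≢w ∘ S⊆w) x~z (go k z∈L dz≡k)

    leaving-walk-visits-leg : (p : Walk G y z k) → OnLeg y → ¬ OnLeg z →
                              OnLeg x → dist u y ≤ dist u x → x ∈ˡ verts G p
    leaving-walk-visits-leg nil y∈L z∉L _ _ = contradiction y∈L z∉L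
    leaving-walk-visits-leg {y} {x = x} (cons {w = y'} y~y' p) y∈L z∉L x∈L dy≤dx with y' ≟ᶠ w
    ... | yes refl = here (on-leg-dist-injective x∈L y∈L (≤-antisym dx≤dy dy≤dx))
      where
      dx≤dy : dist u x ≤ dist u y
      dx≤dy = s≤s⁻¹ (subst (dist u x <_) (sym (adj-w⇒1+dist≡leg-length y∈L y~y')) (dist<leg-length x∈L))
    ... | no y'≢w with dist u x ≟ dist u y
    ...   | yes dx≡dy = here (on-leg-dist-injective x∈L y∈L dx≡dy)
    ...   | no  dx≢dy = there (leaving-walk-visits-leg p (step-on-leg y∈L y~y' y'≢w) z∉L x∈L dy'≤dx)
      where
      dy'≤dx : dist u y' ≤ dist u x
      dy'≤dx = begin
        dist u y'             ≤⟨ dist-triangle u y y' ⟩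
        dist u y + dist y y'  ≡⟨ cong (dist u y +_) (adj⇒dist≡1 y~y') ⟩
        dist u y + 1          ≡⟨ +-comm (dist u y) 1 ⟩
        suc (dist u y)        ≤⟨ ≤∧≢⇒< dy≤dx (dx≢dy ∘ sym) ⟩
        dist u x              ∎
        where open ≤-Reasoning

    top-exists : ∃ λ v → adj w v ≡ true × OnLeg v
    top-exists with closer-neighbour (u≢w ∘ sym)
    ... | v , w~v , closer = v , w~v , (adj⇒≢ w~v ∘ sym) , (begin
      dist u v + dist v w   ≡⟨ cong₂ _+_ (dist-sym u v) (adj⇒dist≡1 (trans (adj-sym v w) w~v)) ⟩
      dist v u + 1          ≡⟨ +-comm (dist v u) 1 ⟩
      suc (dist v u)        ≡⟨ closer ⟩
      dist w u              ≡⟨ dist-sym w u ⟩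
      leg-length            ∎)
      where open ≡-Reasoning

    top : Fin n
    top = proj₁ top-exists

    w~top : adj w top ≡ true
    w~top = proj₁ (proj₂ top-exists)

    top-on-leg : OnLeg top
    top-on-leg = proj₂ (proj₂ top-exists)

    top~w : adj top w ≡ true
    top~w = trans (adj-sym top w) w~top

    adj-w⇒≡top : adj w x ≡ true → OnLeg x → x ≡ top
    adj-w⇒≡top {x} w~x x∈L = on-leg-dist-injective x∈L top-on-leg (suc-injective (trans
      (adj-w⇒1+dist≡leg-length x∈L (trans (adj-sym x w) w~x))
      (sym (adj-w⇒1+dist≡leg-length top-on-leg top~w))))

    dist-top<dist-w : OnLeg x → dist x top < dist x w
    dist-top<dist-w x∈L = go _ x∈L refl
      where
      go : ∀ d {x} → OnLeg x → dist x w ≡ d → dist x top < d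
      go zero    (x≢w , _) dx≡0 = contradiction (dist≡0⇒≡ dx≡0) x≢w
      go (suc d) {x} x∈L dx≡1+d with next (successor x∈L) ≟ᶠ w
      ... | yes next≡w = subst (λ t → dist t top < suc d) (sym x≡top) (subst (_< suc d) (sym (dist-refl top)) z<s)
        where
        x≡top : x ≡ top
        x≡top = adj-w⇒≡top (trans (adj-sym w x) (subst (λ t → adj x t ≡ true) next≡w (adj-next (successor x∈L))))
                           x∈L
      ... | no  next≢w = begin-strict
        dist x top                          ≤⟨ dist-triangle x (next s) top ⟩
        dist x (next s) + dist (next s) top ≡⟨ cong (_+ dist (next s) top) (adj⇒dist≡1 (adj-next s)) ⟩
        suc (dist (next s) top)             <⟨ s≤s (go d (step-on-leg x∈L (adj-next s) next≢w)
                                                       (suc-injective (trans (next-closer s) dx≡1+d))) ⟩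
        suc d                               ∎
        where
        open ≤-Reasoning
        s = successor x∈L

    dist-top-w≡1 : dist top w ≡ 1
    dist-top-w≡1 = adj⇒dist≡1 top~w

    reaches-top : (∀ {z} → S z → z ≡ w) → OnLeg x → WalkAvoid G S x top
    reaches-top S⊆w x∈L = descent S⊆w x∈L ++ᵃ reverseᵃ (descent S⊆w top-on-leg)

    off-leg-¬reaches-top : S w → ¬ OnLeg x → ¬ WalkAvoid G S x top
    off-leg-¬reaches-top Sw x∉L q = x∉L (avoiding-w-stays-on-leg Sw (reverseᵃ q) top-on-leg)

  PathThrough : Fin n → Fin n → Fin n → ℕ → Set
  PathThrough w x y l = Σ (Walk G x y l) λ p → IsPath G p × w ∈ˡ verts G p

  module TwoLegs {w uⱼ uᵣ : Fin n} (tⱼ : Terminal G w uⱼ) (tᵣ : Terminal G w uᵣ) (uⱼ≢uᵣ : uⱼ ≢ uᵣ) where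
    module J = Leg tⱼ
    module R = Leg tᵣ

    ¬both-legs : J.OnLeg x → ¬ R.OnLeg x
    ¬both-legs x∈J x∈R = uⱼ≢uᵣ (R.end-vertex-on-leg uⱼ∈R J.u-end)
      where
      uⱼ∈R : R.OnLeg uⱼ
      uⱼ∈R = R.avoiding-w-stays-on-leg {S = _≡ w} refl (J.descent (λ z≡w → z≡w) x∈J) x∈R

    nearer-own-top : J.OnLeg x → dist J.top x < dist R.top x
    nearer-own-top {x} x∈J = begin-strict
      dist J.top x            ≡⟨ dist-sym J.top x ⟩
      dist x J.top            <⟨ J.dist-top<dist-w x∈J ⟩
      dist x w                <⟨ n<1+n (dist x w) ⟩
      suc (dist x w)          ≡⟨ cong₂ _+_ R.dist-top-w≡1 (dist-sym w x) ⟨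
      dist R.top w + dist w x ≤⟨ R.dist-leaving-leg R.top-on-leg (¬both-legs x∈J) ⟩
      dist R.top x            ∎
      where open ≤-Reasoning

    path-through-w : ∃ (PathThrough w uⱼ uᵣ)
    path-through-w with walk⇒path (geodesic uⱼ w ++ʷ geodesic w uᵣ)
    ... | l , p , p-path , _ with w ∈ˡ? verts G p
    ...   | yes w∈p = l , p , p-path , w∈p
    ...   | no  w∉p = contradiction R.u-on-leg (¬both-legs uᵣ∈J)
      where
      uᵣ∈J : J.OnLeg uᵣ
      uᵣ∈J = J.avoiding-w-stays-on-leg {S = _≡ w} refl
               (walk⇒avoiding p (All.map (_∘ sym) (¬Any⇒All¬ (verts G p) w∉p))) J.u-on-leg

  module Separation {w uⱼ uᵣ : Fin n} (tⱼ : Terminal G w uⱼ) (tᵣ : Terminal G w uᵣ) (uⱼ≢uᵣ : uⱼ ≢ uᵣ) where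
    open TwoLegs tⱼ tᵣ uⱼ≢uᵣ public
    private module Swapped = TwoLegs tᵣ tⱼ (uⱼ≢uᵣ ∘ sym)

    w-separates : CommonSep G 1 J.top R.top ⁅ w ⁆
    w-separates with major⇒other-neighbour J.w-major J.top R.top
    ... | z , w~z , z≢topⱼ , z≢topᵣ =
      spheres , (J.top , z , x≢y⇒x∉⁅y⁆ (proj₁ J.top-on-leg) , x≢y⇒x∉⁅y⁆ z≢w , top↛z) ,
      (z , x≢y⇒x∉⁅y⁆ z≢w , J.off-leg-¬reaches-top (x∈⁅x⁆ w) z∉J , R.off-leg-¬reaches-top (x∈⁅x⁆ w) z∉R)
      where
      spheres : ∀ x → x ∈ ⁅ w ⁆ → Sphere G J.top 1 x × Sphere G R.top 1 x
      spheres x x∈⁅w⁆ rewrite x∈⁅y⁆⇒x≡y w x∈⁅w⁆ =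
        adj⇒Dist1 J.top~w , adj⇒Dist1 R.top~w
      z≢w : z ≢ w
      z≢w = adj⇒≢ w~z ∘ sym
      z∉J : ¬ J.OnLeg z
      z∉J z∈J = z≢topⱼ (J.adj-w⇒≡top w~z z∈J)
      z∉R : ¬ R.OnLeg z
      z∉R z∈R = z≢topᵣ (R.adj-w⇒≡top w~z z∈R)
      top↛z : ¬ WalkAvoid G (_∈ ⁅ w ⁆) J.top z
      top↛z q = z∉J (J.avoiding-w-stays-on-leg (x∈⁅x⁆ w) q J.top-on-leg)

    tops-P₁ : Pm G 1 J.top R.top
    tops-P₁ = (λ topⱼ≡topᵣ → ¬both-legs J.top-on-leg (subst R.OnLeg (sym topⱼ≡topᵣ) R.top-on-leg)) , ⁅ w ⁆ , w-separates

    InS₁⇒≡w : InSm G 1 J.top R.top x → x ≡ w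
    InS₁⇒≡w {x} (_ , (spheres , _) , x∈S) with x ≟ᶠ w
    ... | yes x≡w = x≡w
    ... | no  x≢w = contradiction (R.step-on-leg R.top-on-leg (Dist1⇒adj (proj₂ (spheres x x∈S))) x≢w)
                                  (¬both-legs (J.step-on-leg J.top-on-leg (Dist1⇒adj (proj₁ (spheres x x∈S))) x≢w))

    w-InS₁ : InSm G 1 J.top R.top w
    w-InS₁ = ⁅ w ⁆ , w-separates , x∈⁅x⁆ w

    OnLegs : Fin n → Set
    OnLegs x = J.OnLeg x ⊎ R.OnLeg x

    Resolving : Fin n → Set
    Resolving x = ¬ InC G 1 J.top R.top x × ∃[ a ] ∃[ b ] (Dist G J.top x a × Dist G R.top x b × a ≢ b)

    on-legs⇒resolving : ∀ x → OnLegs x → Resolving x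
    on-legs⇒resolving x (inj₁ x∈J) =
      (λ (_ , x↛topⱼ , _) → x↛topⱼ (J.reaches-top InS₁⇒≡w x∈J)) ,
      _ , _ , dist-is-Dist J.top x , dist-is-Dist R.top x , <⇒≢ (nearer-own-top x∈J)
    on-legs⇒resolving x (inj₂ x∈R) =
      (λ (_ , _ , x↛topᵣ) → x↛topᵣ (R.reaches-top InS₁⇒≡w x∈R)) ,
      _ , _ , dist-is-Dist J.top x , dist-is-Dist R.top x , <⇒≢ (Swapped.nearer-own-top x∈R) ∘ sym

    resolving⇒on-legs : ∀ x → Resolving x → OnLegs x
    resolving⇒on-legs x (x∉C , a , b , da , db , a≢b) with J.on-leg? x | R.on-leg? x
    ... | yes x∈J | _       = inj₁ x∈J
    ... | no _    | yes x∈R = inj₂ x∈R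
    ... | no x∉J  | no x∉R with x ≟ᶠ w
    ...   | yes refl = contradiction (trans (trans (Dist⇒≡dist da) J.dist-top-w≡1)
                                            (sym (trans (Dist⇒≡dist db) R.dist-top-w≡1)))
                                     a≢b
    ...   | no  x≢w  = contradiction (x≢w ∘ InS₁⇒≡w , J.off-leg-¬reaches-top w-InS₁ x∉J ,
                                                     R.off-leg-¬reaches-top w-InS₁ x∉R)
                                     x∉C

    legs-count : ∃ (Count OnLegs)
    legs-count = count-exists λ x → J.on-leg? x ⊎-dec R.on-leg? x

    μ₁-tops : μpair G 1 J.top R.top (proj₁ legs-count)
    μ₁-tops = tops-P₁ , count-resp on-legs⇒resolving resolving⇒on-legs (proj₂ legs-count)

    legs≤ς : ∀ {c b} → Count OnLegs c → ςpair G w uⱼ uᵣ b → c ≤ b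
    legs≤ς (T , T⊆legs , _ , ∣T∣≡c) ((p , _ , w∈p) , _) =
      s≤s⁻¹ (subst₂ _<_ ∣T∣≡c (verts-length p) (∣p∣<length T (verts G p) T⊆p w∈p w∉T))
      where
      dist-refl≤ : ∀ u y → dist u u ≤ dist u y
      dist-refl≤ u y = subst (_≤ dist u y) (sym (dist-refl u)) z≤n
      T⊆p : ∀ {y} → y ∈ T → y ∈ˡ verts G p
      T⊆p {y} y∈T with T⊆legs y y∈T
      ... | inj₁ y∈J = J.leaving-walk-visits-leg p J.u-on-leg (λ uᵣ∈J → ¬both-legs uᵣ∈J R.u-on-leg) y∈J (dist-refl≤ uⱼ y)
      ... | inj₂ y∈R = ∈-verts-reverse p
            (R.leaving-walk-visits-leg (reverseʷ p) R.u-on-leg (¬both-legs J.u-on-leg) y∈R (dist-refl≤ uᵣ y))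
      w∉T : w ∉ T
      w∉T w∈T with T⊆legs w w∈T
      ... | inj₁ (w≢w , _) = w≢w refl
      ... | inj₂ (w≢w , _) = w≢w refl

  -- Decidability

  Dist? : ∀ x y → Decidable (Dist G x y)
  Dist? x y = least? (walk? x y)

  terminal? : ∀ w u → Dec (Terminal G w u)
  terminal? w u = map′ to from ((deg G u ≟ 1 ×-dec 3 ≤? deg G w) ×-dec
                                all? λ x → 3 ≤? deg G x →-dec ¬? (x ≟ᶠ w) →-dec suc (dist u w) ≤? dist u x)
    where
    Nearest : Set
    Nearest = ∀ x → Major G x → x ≢ w → dist u w < dist u x
    to : (EndVertex G u × Major G w) × Nearest → Terminal G w u
    to ((u-end , w-major) , nearest) = u-end , w-major , dist u w , dist-is-Dist u w ,
      λ x x-major x≢w _ d → subst (dist u w <_) (sym (Dist⇒≡dist d)) (nearest x x-major x≢w)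
    from : Terminal G w u → (EndVertex G u × Major G w) × Nearest
    from t@(u-end , w-major , _) = (u-end , w-major) , λ _ → terminal⇒nearest t

  InM? : Decidable (InM G)
  InM? w with count-exists (terminal? w)
  ... | c , ter-c = map′ to from ((3 ≤? deg G w ×-dec 1 ≤? c) ×-dec 1 <? c)
    where
    to : (Major G w × 1 ≤ c) × 1 < c → InM G w
    to ((w-major , 1≤c) , 1<c) = (w-major , c , ter-c , 1≤c) , c , ter-c , 1<c
    from : InM G w → (Major G w × 1 ≤ c) × 1 < c
    from ((w-major , k , ter-k , 1≤k) , k' , ter-k' , 1<k') =
      (w-major , subst (1 ≤_) (count-unique ter-k ter-c) 1≤k) , subst (1 <_) (count-unique ter-k' ter-c) 1<k'

  path-through? : ∀ w x y → Decidable (PathThrough w x y)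
  path-through? w x y = walkWith? {λ xs → Unique xs × w ∈ˡ xs} (λ xs → DecUnique.unique? _≟ᶠ_ xs ×-dec w ∈ˡ? xs) x y

  TerminalPair : Fin n → ℕ → Set
  TerminalPair w l = ∃[ uⱼ ] ∃[ uᵣ ] (uⱼ ≢ uᵣ × Terminal G w uⱼ × Terminal G w uᵣ × ςpair G w uⱼ uᵣ l)

  terminal-pair? : ∀ w → Decidable (TerminalPair w)
  terminal-pair? w l = any? λ uⱼ → any? λ uᵣ →
    ¬? (uⱼ ≟ᶠ uᵣ) ×-dec terminal? w uⱼ ×-dec terminal? w uᵣ ×-dec least? (path-through? w uⱼ uᵣ) l

  ςG-candidate? : Decidable (λ l → ∃[ w ] (InM G w × ςvertex G w l))
  ςG-candidate? l = any? λ w → InM? w ×-dec least? (terminal-pair? w) l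

  commonSep? : ∀ m v v' S → Dec (CommonSep G m v v' S)
  commonSep? m v v' S =
    all? (λ x → x ∈ˢ? S →-dec Dist? v x m ×-dec Dist? v' x m) ×-dec
    (any? λ x → any? λ y → ¬? (x ∈ˢ? S) ×-dec ¬? (y ∈ˢ? S) ×-dec ¬? (avoiding? (_∈ˢ? S) x y)) ×-dec
    (any? λ x → ¬? (x ∈ˢ? S) ×-dec ¬? (avoiding? (_∈ˢ? S) x v) ×-dec ¬? (avoiding? (_∈ˢ? S) x v'))

  Pm? : ∀ m v v' → Dec (Pm G m v v')
  Pm? m v v' = ¬? (v ≟ᶠ v') ×-dec anySubset? (commonSep? m v v')

  InSm? : ∀ m v v' → Decidable (InSm G m v v')
  InSm? m v v' x = anySubset? λ S → commonSep? m v v' S ×-dec x ∈ˢ? S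

  InC? : ∀ m v v' → Decidable (InC G m v v')
  InC? m v v' x = ¬? (InSm? m v v' x) ×-dec ¬? (avoiding? (InSm? m v v') x v) ×-dec ¬? (avoiding? (InSm? m v v') x v')

  resolves? : ∀ v v' x → Dec (∃[ a ] ∃[ b ] (Dist G v x a × Dist G v' x b × a ≢ b))
  resolves? v v' x = map′ to from (¬? (dist v x ≟ dist v' x))
    where
    to : dist v x ≢ dist v' x → ∃[ a ] ∃[ b ] (Dist G v x a × Dist G v' x b × a ≢ b)
    to d≢d = _ , _ , dist-is-Dist v x , dist-is-Dist v' x , d≢d
    from : ∃[ a ] ∃[ b ] (Dist G v x a × Dist G v' x b × a ≢ b) → dist v x ≢ dist v' x
    from (_ , _ , da , db , a≢b) d≡d = a≢b (trans (Dist⇒≡dist da) (trans d≡d (sym (Dist⇒≡dist db))))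

  μpair? : ∀ m v v' → Decidable (μpair G m v v')
  μpair? m v v' l = Pm? m v v' ×-dec count? (λ x → ¬? (InC? m v v' x) ×-dec resolves? v v' x) l

  μm-candidate? : ∀ m → Decidable (λ l → ∃[ v ] ∃[ v' ] (Pm G m v v' × μpair G m v v' l))
  μm-candidate? m l = any? λ v → any? λ v' → Pm? m v v' ×-dec μpair? m v v' l

  separator-nonempty : ∀ {T : Subset n} → VertexSeparator G T → ∃ (_∈ T)
  separator-nonempty {T} (x , y , _ , _ , x↛y) with any? (_∈ˢ? T)
  ... | yes nonempty = nonempty
  ... | no  empty    =
    contradiction (walk⇒avoiding (proj₂ (connected x y)) (All.tabulate λ _ z∈T → empty (_ , z∈T))) x↛y

  Pm⇒radius : ∀ {m v v'} → Pm G m v v' → ∃ λ y → m ≡ dist v y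
  Pm⇒radius (_ , _ , spheres , separator , _) with separator-nonempty separator
  ... | y , y∈S = y , Dist⇒≡dist (proj₁ (spheres y y∈S))

  -- m ranges over ℕ, but by Pm⇒radius only the finitely many distances dist v y can occur.
  μG-candidate? : Decidable (λ l → ∃[ m ] (1 ≤ m × μm G m l))
  μG-candidate? l = map′ to from (any? λ v → any? λ y → 1 ≤? dist v y ×-dec least? (μm-candidate? (dist v y)) l)
    where
    to : (∃ λ v → ∃ λ y → 1 ≤ dist v y × μm G (dist v y) l) → ∃[ m ] (1 ≤ m × μm G m l)
    to (v , y , 1≤m , μm-l) = dist v y , 1≤m , μm-l
    from : ∃[ m ] (1 ≤ m × μm G m l) → ∃ λ v → ∃ λ y → 1 ≤ dist v y × μm G (dist v y) l
    from (m , 1≤m , μm-l@((v , _ , v-pair , _) , _)) with Pm⇒radius v-pair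
    ... | y , refl = v , y , 1≤m , μm-l

  -- Existence of the minima

  ςG-from-pair : ∀ {w uⱼ uᵣ} → InM G w → Terminal G w uⱼ → Terminal G w uᵣ → uⱼ ≢ uᵣ → ∃ (ςG G)
  ςG-from-pair {w} {uⱼ} {uᵣ} w∈M tⱼ tᵣ uⱼ≢uᵣ =
    let _ , path         = TwoLegs.path-through-w tⱼ tᵣ uⱼ≢uᵣ
        _ , ςpair-uⱼuᵣ   = least-exists (path-through? w uⱼ uᵣ) path
        _ , ςvertex-w    = least-exists (terminal-pair? w) (uⱼ , uᵣ , uⱼ≢uᵣ , tⱼ , tᵣ , ςpair-uⱼuᵣ)
    in least-exists ςG-candidate? (w , w∈M , ςvertex-w)

  ςG-exists : ∃[ w ] InM G w → ∃ (ςG G)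
  ςG-exists (w , w∈M@(_ , _ , (T , T⊆ter , _ , ∣T∣≡k) , 1<k)) with two-distinct T (subst (1 <_) (sym ∣T∣≡k) 1<k)
  ... | uⱼ , uᵣ , uⱼ∈T , uᵣ∈T , uⱼ≢uᵣ = ςG-from-pair w∈M (T⊆ter uⱼ uⱼ∈T) (T⊆ter uᵣ uᵣ∈T) uⱼ≢uᵣ

  μG-below : ∀ {m v v' c} → 1 ≤ m → μpair G m v v' c → ∃ λ a → μG G a × a ≤ c
  μG-below {m} {v} {v'} {c} 1≤m μ-c@(v-pair , _) =
    let a₁ , μm-a₁ = least-exists (μm-candidate? m) (v , v' , v-pair , μ-c)
        a  , μG-a  = least-exists μG-candidate? (m , 1≤m , μm-a₁)
    in a , μG-a , ≤-trans (proj₂ μG-a a₁ (m , 1≤m , μm-a₁)) (proj₂ μm-a₁ c (v , v' , v-pair , μ-c))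

  ςG-bounds-μG : ∀ {b} → ςG G b → PNonempty G × ∃ λ a → μG G a × a ≤ b
  ςG-bounds-μG ((_ , _ , (_ , _ , uⱼ≢uᵣ , tⱼ , tᵣ , ςpair-b) , _) , _) =
    let a , μG-a , a≤μ₁ = μG-below (s≤s z≤n) μ₁-tops
    in (1 , J.top , R.top , s≤s z≤n , tops-P₁) , a , μG-a , ≤-trans a≤μ₁ (legs≤ς (proj₂ legs-count) ςpair-b)
    where open Separation tⱼ tᵣ uⱼ≢uᵣ

proposition2p20 : ∀ {n} (G : Graph n) → Connected G → ∃[ w ] InM G w →
    PNonempty G × ∃[ a ] ∃[ b ] (μG G a × ςG G b × a ≤ b)
proposition2p20 G connected ∃M =
  let b , ςG-b                    = ςG-exists ∃M
      P-nonempty , a , μG-a , a≤b = ςG-bounds-μG ςG-b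
  in P-nonempty , a , b , μG-a , ςG-b , a≤b
  where open Distances G connected
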